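{- Let $k\in\mathbb{N}$ and let $T$ be a tree on $n\ge 2k$ vertices. Then there exist sets $V_A,V_B$ with $V(T)=V_A\cup V_B$ such that $T[V_A]$ and $T[V_B]$ are trees, $|V_A\cap V_B|\le 1$, and $k\le|V_A|<2k$.
   Context: $T[X]$ denotes the subgraph of $T$ induced by the vertex set $X$. -}

module Defs where

open import Data.Nat using (ℕ; _≤_)
open import Data.Fin using (Fin)
open import Data.Fin.Subset using (Subset; _∈_)
open import Data.List using (List; []; _∷_; _++_; length)
open import Data.List.Relation.Unary.All using (All)
open import Data.List.Relation.Unary.Unique.Propositional using (Unique)
open import Data.Product using (Σ; _×_; ∃)
open import Data.Unit using (⊤)
open import Data.Empty using (⊥)
open import Relation.Nullary using (¬_; Dec)

record Graph (n : ℕ) : Set₁ where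
  field
    Adj    : Fin n → Fin n → Set
    adj?   : ∀ u v → Dec (Adj u v)
    sym    : ∀ {u v} → Adj u v → Adj v u
    irrefl : ∀ {u} → ¬ Adj u u

module _ {n : ℕ} (G : Graph n) where
  open Graph G

  Chain : List (Fin n) → Set
  Chain []           = ⊤
  Chain (x ∷ [])     = ⊤
  Chain (x ∷ y ∷ xs) = Adj x y × Chain (y ∷ xs)

  data WalkIn (S : Subset n) : Fin n → Fin n → Set where
    here : ∀ {u} → u ∈ S → WalkIn S u u
    step : ∀ {u w v} → u ∈ S → Adj u w → WalkIn S w v → WalkIn S u v

  -- x ∷ xs is a cycle of G[S]: at least 3 distinct vertices of S,
  -- consecutive ones adjacent, and the last adjacent to the first
  IsCycleIn : Subset n → List (Fin n) → Set
  IsCycleIn S []       = ⊥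
  IsCycleIn S (x ∷ xs) =
    2 ≤ length xs × Unique (x ∷ xs) × All (_∈ S) (x ∷ xs) × Chain (x ∷ xs ++ x ∷ [])

  ConnectedOn : Subset n → Set
  ConnectedOn S = (∃ λ v → v ∈ S) × (∀ u v → u ∈ S → v ∈ S → WalkIn S u v)

  AcyclicOn : Subset n → Set
  AcyclicOn S = ∀ c → ¬ IsCycleIn S c

  IsTreeOn : Subset n → Set
  IsTreeOn S = ConnectedOn S × AcyclicOn S

IsTree : {n : ℕ} → Graph n → Set
IsTree G = IsTreeOn G Data.Fin.Subset.⊤

-- Acyclicity passes to induced subgraphs, so only connectivity matters, and the
-- theorem holds for every connected graph. Recurse on a connected set R with a
-- connected set P glued to it at a single vertex r, where |P| ≤ k ≤ |R ∪ P|.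
-- If |R ∪ P| < 2k, take VA = R ∪ P and VB = {r}. Otherwise cut R along an edge rc
-- into the component `near` of c in R − r and the connected rest `far` ∋ r.
-- If k ≤ |near|, split near (with {c} glued at c, so that c lies in its VB) and
-- attach far ∪ P to that VB through the edge rc; if |near| < k ≤ |P ∪ near|, take
-- VA = P ∪ near and VB = far; otherwise recurse on far with P ∪ near glued at r.
module Submission where

open import Defs
open import Data.Nat using (ℕ; zero; suc; _+_; _*_; _≤_; _<_; z≤n; s≤s; _≤?_; _<?_)
open import Data.Nat.Induction using (<-wellFounded)
open import Data.Nat.Properties
  using (≤-trans; <-≤-trans; ≤-<-trans; ≤-reflexive; n≤1+n; +-suc; +-identityʳ; +-comm; m≤m+n;
         +-monoʳ-≤; +-monoˡ-≤; +-mono-≤-<; m≤n+m; ≮⇒≥; ≰⇒>; <⇒≤; <⇒≱)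
open import Data.Fin using (Fin) renaming (_≟_ to _≟ᶠ_)
open import Data.Fin.Properties using (any?)
open import Data.Fin.Subset
  using (Subset; inside; outside; _∈_; _∉_; _⊆_; _⊂_; _∪_; _∩_; _─_; _-_; ⁅_⁆; ⊤; ∣_∣)
open import Data.Fin.Subset.Properties
open import Data.Vec.Base using ([]; _∷_; here; there)
open import Data.Product using (Σ; _×_; _,_; proj₂)
open import Data.Sum using (inj₁; inj₂)
open import Data.List using (_∷_)
import Data.List.Relation.Unary.All as All
open import Induction.WellFounded using (Acc; acc)
open import Relation.Nullary using (¬_; Dec; yes; no; contradiction)
open import Relation.Nullary.Decidable using (_×-dec_; ¬?)
open import Relation.Binary.PropositionalEquality
  using (_≡_; _≢_; refl; sym; trans; subst; cong; module ≡-Reasoning)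

∣p∪q∣≤∣p∣+∣q∣ : ∀ {n} (p q : Subset n) → ∣ p ∪ q ∣ ≤ ∣ p ∣ + ∣ q ∣
∣p∪q∣≤∣p∣+∣q∣ [] [] = z≤n
∣p∪q∣≤∣p∣+∣q∣ (inside ∷ p) (inside ∷ q) =
  s≤s (≤-trans (∣p∪q∣≤∣p∣+∣q∣ p q) (+-monoʳ-≤ ∣ p ∣ (n≤1+n ∣ q ∣)))
∣p∪q∣≤∣p∣+∣q∣ (inside ∷ p) (outside ∷ q) = s≤s (∣p∪q∣≤∣p∣+∣q∣ p q)
∣p∪q∣≤∣p∣+∣q∣ (outside ∷ p) (inside ∷ q) =
  subst (suc ∣ p ∪ q ∣ ≤_) (sym (+-suc ∣ p ∣ ∣ q ∣)) (s≤s (∣p∪q∣≤∣p∣+∣q∣ p q))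
∣p∪q∣≤∣p∣+∣q∣ (outside ∷ p) (outside ∷ q) = ∣p∪q∣≤∣p∣+∣q∣ p q

x∈p─q⇒x∉q : ∀ {n} {x : Fin n} (p q : Subset n) → x ∈ p ─ q → x ∉ q
x∈p─q⇒x∉q (_ ∷ p) (inside ∷ q) () here
x∈p─q⇒x∉q (_ ∷ p) (_ ∷ q) (there x∈p─q) (there x∈q) = x∈p─q⇒x∉q p q x∈p─q x∈q

n≤2*n : ∀ n → n ≤ 2 * n
n≤2*n n = m≤m+n n (n + 0)

n+n≡2*n : ∀ n → n + n ≡ 2 * n
n+n≡2*n n = cong (n +_) (sym (+-identityʳ n))

1≤n⇒n<2*n : ∀ {n} → 1 ≤ n → n < 2 * n
1≤n⇒n<2*n {n} 1≤n =
  ≤-trans (≤-reflexive (+-comm 1 n)) (≤-trans (+-monoʳ-≤ n 1≤n) (≤-reflexive (n+n≡2*n n)))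

module _ {n : ℕ} where

  ⁅x⁆⊆p : ∀ {x} {p : Subset n} → x ∈ p → ⁅ x ⁆ ⊆ p
  ⁅x⁆⊆p {x} {p} x∈p y∈⁅x⁆ = subst (_∈ p) (sym (x∈⁅y⁆⇒x≡y x y∈⁅x⁆)) x∈p

  ∪-lub : ∀ {p q r : Subset n} → p ⊆ r → q ⊆ r → p ∪ q ⊆ r
  ∪-lub {p} {q} p⊆r q⊆r x∈p∪q with x∈p∪q⁻ p q x∈p∪q
  ... | inj₁ x∈p = p⊆r x∈p
  ... | inj₂ x∈q = q⊆r x∈q

  q⊆p⇒p∪q≡p : ∀ {p q : Subset n} → q ⊆ p → p ∪ q ≡ p
  q⊆p⇒p∪q≡p {p} q⊆p = ⊆-antisym (∪-lub ⊆-refl q⊆p) (p⊆p∪q _)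

  p⊆q⇒p∪[q─p]≡q : ∀ {p q : Subset n} → p ⊆ q → p ∪ (q ─ p) ≡ q
  p⊆q⇒p∪[q─p]≡q {p} {q} p⊆q = ⊆-antisym (∪-lub p⊆q (p─q⊆p q p)) q⊆p∪[q─p]
    where
    q⊆p∪[q─p] : q ⊆ p ∪ (q ─ p)
    q⊆p∪[q─p] {x} x∈q with x ∈? p
    ... | yes x∈p = p⊆p∪q (q ─ p) x∈p
    ... | no x∉p = q⊆p∪q p (q ─ p) (x∈p∧x∉q⇒x∈p─q x∈q x∉p)

module _ {n : ℕ} (G : Graph n) where
  open Graph G renaming (sym to adj-sym)

  WalkIn-start : ∀ {S u v} → WalkIn G S u v → u ∈ S
  WalkIn-start (here u∈S) = u∈S
  WalkIn-start (step u∈S _ _) = u∈S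

  infixr 5 _++ʷ_
  _++ʷ_ : ∀ {S u v w} → WalkIn G S u v → WalkIn G S v w → WalkIn G S u w
  here _ ++ʷ v⇝w = v⇝w
  step u∈S u~x x⇝v ++ʷ v⇝w = step u∈S u~x (x⇝v ++ʷ v⇝w)

  WalkIn-reverse : ∀ {S u v} → WalkIn G S u v → WalkIn G S v u
  WalkIn-reverse (here u∈S) = here u∈S
  WalkIn-reverse (step u∈S u~x x⇝v) =
    WalkIn-reverse x⇝v ++ʷ step (WalkIn-start x⇝v) (adj-sym u~x) (here u∈S)

  WalkIn-mono : ∀ {S S′ u v} → S ⊆ S′ → WalkIn G S u v → WalkIn G S′ u v
  WalkIn-mono S⊆S′ (here u∈S) = here (S⊆S′ u∈S)
  WalkIn-mono S⊆S′ (step u∈S u~x x⇝v) = step (S⊆S′ u∈S) u~x (WalkIn-mono S⊆S′ x⇝v)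

  first-step : ∀ {S u v} → WalkIn G S u v → u ≢ v → Σ (Fin n) λ c → c ∈ S × Adj u c
  first-step (here _) u≢u = contradiction refl u≢u
  first-step (step _ u~x x⇝v) _ = _ , WalkIn-start x⇝v , u~x

  star-connected : ∀ {S c} → c ∈ S → (∀ {u} → u ∈ S → WalkIn G S u c) → ConnectedOn G S
  star-connected c∈S to-c = (_ , c∈S) , λ _ _ u∈S v∈S → to-c u∈S ++ʷ WalkIn-reverse (to-c v∈S)

  ⁅⁆-connected : ∀ r → ConnectedOn G ⁅ r ⁆
  ⁅⁆-connected r = star-connected (x∈⁅x⁆ r) to-r
    where
    to-r : ∀ {u} → u ∈ ⁅ r ⁆ → WalkIn G ⁅ r ⁆ u r
    to-r u∈⁅r⁆ with x∈⁅y⁆⇒x≡y r u∈⁅r⁆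
    ... | refl = here u∈⁅r⁆

  ∪-connected : ∀ {A B a b} → ConnectedOn G A → ConnectedOn G B → a ∈ A → b ∈ B →
                WalkIn G (A ∪ B) a b → ConnectedOn G (A ∪ B)
  ∪-connected {A} {B} {a} {b} (_ , A-walks) (_ , B-walks) a∈A b∈B a⇝b =
    star-connected (p⊆p∪q B a∈A) to-a
    where
    to-a : ∀ {u} → u ∈ A ∪ B → WalkIn G (A ∪ B) u a
    to-a {u} u∈A∪B with x∈p∪q⁻ A B u∈A∪B
    ... | inj₁ u∈A = WalkIn-mono (p⊆p∪q B) (A-walks u a u∈A a∈A)
    ... | inj₂ u∈B = WalkIn-mono (q⊆p∪q A B) (B-walks u b u∈B b∈B) ++ʷ WalkIn-reverse a⇝b

  ∪-connected-at : ∀ {A B x} → ConnectedOn G A → ConnectedOn G B → x ∈ A → x ∈ B →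
                   ConnectedOn G (A ∪ B)
  ∪-connected-at {B = B} A-conn B-conn x∈A x∈B =
    ∪-connected A-conn B-conn x∈A x∈B (here (p⊆p∪q B x∈A))

  ∪-connected-by : ∀ {A B a b} → ConnectedOn G A → ConnectedOn G B → a ∈ A → b ∈ B →
                   Adj a b → ConnectedOn G (A ∪ B)
  ∪-connected-by {A} {B} A-conn B-conn a∈A b∈B a~b =
    ∪-connected A-conn B-conn a∈A b∈B (step (p⊆p∪q B a∈A) a~b (here (q⊆p∪q A B b∈B)))

  AcyclicOn-⊆ : ∀ {S S′} → S ⊆ S′ → AcyclicOn G S′ → AcyclicOn G S
  AcyclicOn-⊆ S⊆S′ acyclic (x ∷ xs) (long , unique , in-S , chain) =
    acyclic (x ∷ xs) (long , unique , All.map S⊆S′ in-S , chain)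

  AdjClosed : Subset n → Subset n → Set
  AdjClosed S Y = ∀ {u w} → u ∈ Y → w ∈ S → Adj u w → w ∈ Y

  WalkIn-restrict : ∀ {S Y u v} → AdjClosed S Y → u ∈ Y → WalkIn G S u v → WalkIn G Y u v
  WalkIn-restrict closed u∈Y (here _) = here u∈Y
  WalkIn-restrict closed u∈Y (step _ u~x x⇝v) =
    step u∈Y u~x (WalkIn-restrict closed (closed u∈Y (WalkIn-start x⇝v) u~x) x⇝v)

  record Component (S : Subset n) (c : Fin n) : Set where
    field
      carrier   : Subset n
      carrier⊆S : carrier ⊆ S
      c∈carrier : c ∈ carrier
      reaches   : ∀ {u} → u ∈ carrier → WalkIn G S u c
      closed    : AdjClosed S carrier

    connected : ConnectedOn G carrier
    connected = star-connected c∈carrier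
      λ u∈carrier → WalkIn-restrict closed u∈carrier (reaches u∈carrier)

  Exit : Subset n → Subset n → Set
  Exit S Y = Σ (Fin n) λ u → Σ (Fin n) λ w → u ∈ Y × w ∈ S × w ∉ Y × Adj u w

  exit? : ∀ S Y → Dec (Exit S Y)
  exit? S Y = any? λ u → any? λ w → (u ∈? Y) ×-dec (w ∈? S) ×-dec ¬? (w ∈? Y) ×-dec adj? u w

  no-exit⇒closed : ∀ {S Y} → ¬ Exit S Y → AdjClosed S Y
  no-exit⇒closed {Y = Y} no-exit {u} {w} u∈Y w∈S u~w with w ∈? Y
  ... | yes w∈Y = w∈Y
  ... | no w∉Y = contradiction (u , w , u∈Y , w∈S , w∉Y , u~w) no-exit

  -- Each step adds a vertex to Y, so the fuel m never runs out.
  grow-component : ∀ {S c} m Y → n < ∣ Y ∣ + m → Y ⊆ S → c ∈ Y → (∀ {u} → u ∈ Y → WalkIn G S u c) →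
         Component S c
  grow-component zero Y bound _ _ _ = contradiction (∣p∣≤n Y) (<⇒≱ (subst (n <_) (+-identityʳ ∣ Y ∣) bound))
  grow-component {S} {c} (suc m) Y bound Y⊆S c∈Y reaches with exit? S Y
  ... | no no-exit = record
    { carrier = Y ; carrier⊆S = Y⊆S ; c∈carrier = c∈Y ; reaches = reaches
    ; closed = no-exit⇒closed no-exit }
  ... | yes (u , w , u∈Y , w∈S , w∉Y , u~w) =
    grow-component m (Y ∪ ⁅ w ⁆) bound′ (∪-lub Y⊆S (⁅x⁆⊆p w∈S)) (p⊆p∪q ⁅ w ⁆ c∈Y) reaches′
    where
    Y⊂Y∪⁅w⁆ : Y ⊂ Y ∪ ⁅ w ⁆
    Y⊂Y∪⁅w⁆ = p⊆p∪q ⁅ w ⁆ , w , q⊆p∪q Y ⁅ w ⁆ (x∈⁅x⁆ w) , w∉Y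
    bound′ : n < ∣ Y ∪ ⁅ w ⁆ ∣ + m
    bound′ = <-≤-trans bound
      (≤-trans (≤-reflexive (+-suc ∣ Y ∣ m)) (+-monoˡ-≤ m (p⊂q⇒∣p∣<∣q∣ Y⊂Y∪⁅w⁆)))
    reaches′ : ∀ {x} → x ∈ Y ∪ ⁅ w ⁆ → WalkIn G S x c
    reaches′ x∈Y∪⁅w⁆ with x∈p∪q⁻ Y ⁅ w ⁆ x∈Y∪⁅w⁆
    ... | inj₁ x∈Y = reaches x∈Y
    ... | inj₂ x∈⁅w⁆ with x∈⁅y⁆⇒x≡y w x∈⁅w⁆
    ... | refl = step w∈S (adj-sym u~w) (reaches u∈Y)

  component : ∀ {S c} → c ∈ S → Component S c
  component {S} {c} c∈S = grow-component (suc n) ⁅ c ⁆ (m≤n+m (suc n) ∣ ⁅ c ⁆ ∣) (⁅x⁆⊆p c∈S) (x∈⁅x⁆ c) to-c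
    where
    to-c : ∀ {u} → u ∈ ⁅ c ⁆ → WalkIn G S u c
    to-c u∈⁅c⁆ with x∈⁅y⁆⇒x≡y c u∈⁅c⁆
    ... | refl = here c∈S

  root∉component : ∀ {R r c} (K : Component (R - r) c) → r ∉ Component.carrier K
  root∉component {R} {r} K r∈K = x∈p─q⇒x∉q R ⁅ r ⁆ (Component.carrier⊆S K r∈K) (x∈⁅x⁆ r)

  -- A walk in R to r starting outside the component cannot enter it before r,
  -- because the component is closed under adjacency in R − r.
  far-side-connected : ∀ {R r c} → ConnectedOn G R → r ∈ R → (K : Component (R - r) c) →
                       ConnectedOn G (R ─ Component.carrier K)
  far-side-connected {R} {r} (_ , R-walks) r∈R K =
    star-connected r∈far λ u∈far → avoid u∈far (R-walks _ r (p─q⊆p R near u∈far) r∈R)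
    where
    open Component K renaming (carrier to near)
    r∈far : r ∈ R ─ near
    r∈far = x∈p∧x∉q⇒x∈p─q r∈R (root∉component K)
    avoid : ∀ {u} → u ∈ R ─ near → WalkIn G R u r → WalkIn G (R ─ near) u r
    avoid u∈far (here _) = here u∈far
    avoid {u} u∈far (step _ u~w w⇝r) with u ≟ᶠ r
    ... | yes refl = here u∈far
    ... | no u≢r = step u∈far u~w (avoid w∈far w⇝r)
      where
      u∈R-r : u ∈ R - r
      u∈R-r = x∈p∧x≢y⇒x∈p-y (p─q⊆p R near u∈far) u≢r
      w∈far : _ ∈ R ─ near
      w∈far = x∈p∧x∉q⇒x∈p─q (WalkIn-start w⇝r)
        λ w∈near → x∈p─q⇒x∉q R near u∈far (closed w∈near u∈R-r (adj-sym u~w))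

module _ {n : ℕ} (G : Graph n) (k : ℕ) where
  open Graph G renaming (sym to adj-sym)

  record BalancedSplit (U : Subset n) (r : Fin n) : Set where
    field
      VA VB        : Subset n
      union        : VA ∪ VB ≡ U
      VA-connected : ConnectedOn G VA
      VB-connected : ConnectedOn G VB
      ∣VA∩VB∣≤1    : ∣ VA ∩ VB ∣ ≤ 1
      k≤∣VA∣       : k ≤ ∣ VA ∣
      ∣VA∣<2k      : ∣ VA ∣ < 2 * k
      r∈VB         : r ∈ VB

    VA⊆U : VA ⊆ U
    VA⊆U = subst (VA ⊆_) union (p⊆p∪q VB)

  record Glued (R P : Subset n) (r : Fin n) : Set where
    field
      R-connected : ConnectedOn G R
      P-connected : ConnectedOn G P
      r∈R         : r ∈ R
      r∈P         : r ∈ P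
      R∩P⊆⁅r⁆     : R ∩ P ⊆ ⁅ r ⁆
      ∣P∣≤k       : ∣ P ∣ ≤ k
      k≤∣R∪P∣     : k ≤ ∣ R ∪ P ∣

  take-all : ∀ {R P r} → Glued R P r → ∣ R ∪ P ∣ < 2 * k → BalancedSplit (R ∪ P) r
  take-all {R} {P} {r} g small = record
    { VA = R ∪ P ; VB = ⁅ r ⁆
    ; union = q⊆p⇒p∪q≡p (⁅x⁆⊆p (p⊆p∪q P r∈R))
    ; VA-connected = ∪-connected-at G R-connected P-connected r∈R r∈P
    ; VB-connected = ⁅⁆-connected G r
    ; ∣VA∩VB∣≤1 = ≤-trans (∣p∩q∣≤∣q∣ (R ∪ P) ⁅ r ⁆) (≤-reflexive (∣⁅x⁆∣≡1 r))
    ; k≤∣VA∣ = k≤∣R∪P∣ ; ∣VA∣<2k = small ; r∈VB = x∈⁅x⁆ r }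
    where open Glued g

  module _ (1≤k : 1 ≤ k) where

    glued-⁅⁆ : ∀ {R r} → ConnectedOn G R → r ∈ R → k ≤ ∣ R ∣ → Glued R ⁅ r ⁆ r
    glued-⁅⁆ {R} {r} R-connected r∈R k≤∣R∣ = record
      { R-connected = R-connected ; P-connected = ⁅⁆-connected G r
      ; r∈R = r∈R ; r∈P = x∈⁅x⁆ r ; R∩P⊆⁅r⁆ = p∩q⊆q R ⁅ r ⁆
      ; ∣P∣≤k = subst (_≤ k) (sym (∣⁅x⁆∣≡1 r)) 1≤k
      ; k≤∣R∪P∣ = ≤-trans k≤∣R∣ (∣p∣≤∣p∪q∣ R ⁅ r ⁆) }

    root-neighbour : ∀ {R P r} → Glued R P r → 2 * k ≤ ∣ R ∪ P ∣ → Σ (Fin n) λ c → c ∈ R × Adj r c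
    root-neighbour {R} {P} {r} g large with nonempty? (R - r)
    ... | yes (w , w∈R-r) =
      first-step G (proj₂ R-connected r w r∈R (p─q⊆p R ⁅ r ⁆ w∈R-r))
        λ { refl → x∈p─q⇒x∉q R ⁅ r ⁆ w∈R-r (x∈⁅x⁆ r) }
      where open Glued g
    ... | no R-r-empty = contradiction large (<⇒≱ (≤-<-trans ∣R∪P∣≤k (1≤n⇒n<2*n 1≤k)))
      where
      open Glued g
      R⊆P : R ⊆ P
      R⊆P {x} x∈R with x ≟ᶠ r
      ... | yes refl = r∈P
      ... | no x≢r = contradiction (x , x∈p∧x≢y⇒x∈p-y x∈R x≢r) R-r-empty
      ∣R∪P∣≤k : ∣ R ∪ P ∣ ≤ k
      ∣R∪P∣≤k = ≤-trans (p⊆q⇒∣p∣≤∣q∣ (∪-lub R⊆P ⊆-refl)) ∣P∣≤k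

    module Cut {R P r c} (g : Glued R P r) (c∈R : c ∈ R) (r~c : Adj r c) where
      open Glued g

      near-component : Component G (R - r) c
      near-component = component G (x∈p∧x≢y⇒x∈p-y c∈R c≢r)
        where
        c≢r : c ≢ r
        c≢r refl = irrefl r~c

      open Component near-component renaming (carrier to near; connected to near-connected)

      far : Subset n
      far = R ─ near

      r∉near : r ∉ near
      r∉near = root∉component G near-component

      near⊆R : near ⊆ R
      near⊆R x∈near = p─q⊆p R ⁅ r ⁆ (carrier⊆S x∈near)

      r∈far : r ∈ far
      r∈far = x∈p∧x∉q⇒x∈p─q r∈R r∉near

      far-connected : ConnectedOn G far
      far-connected = far-side-connected G R-connected r∈R near-component

      P∪near-connected : ConnectedOn G (P ∪ near)
      P∪near-connected = ∪-connected-by G P-connected near-connected r∈P c∈carrier r~c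

      ∣near∣<∣R∣ : ∣ near ∣ < ∣ R ∣
      ∣near∣<∣R∣ = p⊂q⇒∣p∣<∣q∣ (near⊆R , r , r∈R , r∉near)

      ∣far∣<∣R∣ : ∣ far ∣ < ∣ R ∣
      ∣far∣<∣R∣ = p∩q≢∅⇒∣p─q∣<∣p∣ R near (c , x∈p∩q⁺ (c∈R , c∈carrier))

      near⇒∉P : ∀ {x} → x ∈ near → x ∉ P
      near⇒∉P x∈near x∈P with x∈⁅y⁆⇒x≡y r (R∩P⊆⁅r⁆ (x∈p∩q⁺ (near⊆R x∈near , x∈P)))
      ... | refl = r∉near x∈near

      [P∪near]∩far⊆⁅r⁆ : (P ∪ near) ∩ far ⊆ ⁅ r ⁆
      [P∪near]∩far⊆⁅r⁆ x∈ with x∈p∩q⁻ (P ∪ near) far x∈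
      ... | x∈P∪near , x∈far with x∈p∪q⁻ P near x∈P∪near
      ... | inj₁ x∈P = R∩P⊆⁅r⁆ (x∈p∩q⁺ (p─q⊆p R near x∈far , x∈P))
      ... | inj₂ x∈near = contradiction x∈near (x∈p─q⇒x∉q R near x∈far)

      near∪far≡R : near ∪ far ≡ R
      near∪far≡R = p⊆q⇒p∪[q─p]≡q near⊆R

      [P∪near]∪far≡R∪P : (P ∪ near) ∪ far ≡ R ∪ P
      [P∪near]∪far≡R∪P = begin
        (P ∪ near) ∪ far  ≡⟨ ∪-assoc P near far ⟩
        P ∪ (near ∪ far)  ≡⟨ cong (P ∪_) near∪far≡R ⟩
        P ∪ R             ≡⟨ ∪-comm P R ⟩
        R ∪ P             ∎
        where open ≡-Reasoning

      far∪[P∪near]≡R∪P : far ∪ (P ∪ near) ≡ R ∪ P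
      far∪[P∪near]≡R∪P = trans (∪-comm far (P ∪ near)) [P∪near]∪far≡R∪P

      extend-near : BalancedSplit near c → BalancedSplit (R ∪ P) r
      extend-near s = record
        { VA = VA ; VB = VB ∪ (far ∪ P) ; union = union′
        ; VA-connected = VA-connected
        ; VB-connected = ∪-connected-by G VB-connected far∪P-connected
            r∈VB (p⊆p∪q P r∈far) (adj-sym r~c)
        ; ∣VA∩VB∣≤1 = ≤-trans (p⊆q⇒∣p∣≤∣q∣ VA∩VB′⊆VA∩VB) ∣VA∩VB∣≤1
        ; k≤∣VA∣ = k≤∣VA∣ ; ∣VA∣<2k = ∣VA∣<2k
        ; r∈VB = q⊆p∪q VB (far ∪ P) (q⊆p∪q far P r∈P) }
        where
        open BalancedSplit s
        far∪P-connected : ConnectedOn G (far ∪ P)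
        far∪P-connected = ∪-connected-at G far-connected P-connected r∈far r∈P
        union′ : VA ∪ (VB ∪ (far ∪ P)) ≡ R ∪ P
        union′ = begin
          VA ∪ (VB ∪ (far ∪ P))  ≡⟨ sym (∪-assoc VA VB (far ∪ P)) ⟩
          (VA ∪ VB) ∪ (far ∪ P)  ≡⟨ cong (_∪ (far ∪ P)) union ⟩
          near ∪ (far ∪ P)       ≡⟨ sym (∪-assoc near far P) ⟩
          (near ∪ far) ∪ P       ≡⟨ cong (_∪ P) near∪far≡R ⟩
          R ∪ P                  ∎
          where open ≡-Reasoning
        VA∩VB′⊆VA∩VB : VA ∩ (VB ∪ (far ∪ P)) ⊆ VA ∩ VB
        VA∩VB′⊆VA∩VB x∈ with x∈p∩q⁻ VA (VB ∪ (far ∪ P)) x∈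
        ... | x∈VA , x∈VB′ with x∈p∪q⁻ VB (far ∪ P) x∈VB′
        ... | inj₁ x∈VB = x∈p∩q⁺ (x∈VA , x∈VB)
        ... | inj₂ x∈far∪P with x∈p∪q⁻ far P x∈far∪P
        ... | inj₁ x∈far = contradiction (VA⊆U x∈VA) (x∈p─q⇒x∉q R near x∈far)
        ... | inj₂ x∈P = contradiction x∈P (near⇒∉P (VA⊆U x∈VA))

      join-near-to-P : ∣ near ∣ < k → k ≤ ∣ P ∪ near ∣ → BalancedSplit (R ∪ P) r
      join-near-to-P ∣near∣<k k≤∣P∪near∣ = record
        { VA = P ∪ near ; VB = far ; union = [P∪near]∪far≡R∪P
        ; VA-connected = P∪near-connected ; VB-connected = far-connected
        ; ∣VA∩VB∣≤1 = ≤-trans (p⊆q⇒∣p∣≤∣q∣ [P∪near]∩far⊆⁅r⁆) (≤-reflexive (∣⁅x⁆∣≡1 r))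
        ; k≤∣VA∣ = k≤∣P∪near∣
        ; ∣VA∣<2k = ≤-<-trans (∣p∪q∣≤∣p∣+∣q∣ P near)
                      (<-≤-trans (+-mono-≤-< ∣P∣≤k ∣near∣<k) (≤-reflexive (n+n≡2*n k)))
        ; r∈VB = r∈far }

      glued-far : ∣ P ∪ near ∣ < k → 2 * k ≤ ∣ R ∪ P ∣ → Glued far (P ∪ near) r
      glued-far ∣P∪near∣<k large = record
        { R-connected = far-connected ; P-connected = P∪near-connected
        ; r∈R = r∈far ; r∈P = p⊆p∪q near r∈P
        ; R∩P⊆⁅r⁆ = subst (_⊆ ⁅ r ⁆) (∩-comm (P ∪ near) far) [P∪near]∩far⊆⁅r⁆
        ; ∣P∣≤k = <⇒≤ ∣P∪near∣<k
        ; k≤∣R∪P∣ = ≤-trans (n≤2*n k) (subst (2 * k ≤_) (sym (cong ∣_∣ far∪[P∪near]≡R∪P)) large) }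

      cut : (∀ {R′ P′ r′} → ∣ R′ ∣ < ∣ R ∣ → Glued R′ P′ r′ → BalancedSplit (R′ ∪ P′) r′) →
            2 * k ≤ ∣ R ∪ P ∣ → BalancedSplit (R ∪ P) r
      cut recurse large with k ≤? ∣ near ∣ | k ≤? ∣ P ∪ near ∣
      ... | yes k≤∣near∣ | _ =
        extend-near (subst (λ U → BalancedSplit U c) (q⊆p⇒p∪q≡p (⁅x⁆⊆p c∈carrier))
          (recurse ∣near∣<∣R∣ (glued-⁅⁆ near-connected c∈carrier k≤∣near∣)))
      ... | no k≰∣near∣ | yes k≤∣P∪near∣ = join-near-to-P (≰⇒> k≰∣near∣) k≤∣P∪near∣
      ... | no _ | no k≰∣P∪near∣ =
        subst (λ U → BalancedSplit U r) far∪[P∪near]≡R∪P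
          (recurse ∣far∣<∣R∣ (glued-far (≰⇒> k≰∣P∪near∣) large))

    balanced-split : ∀ {R P r} → Acc _<_ ∣ R ∣ → Glued R P r → BalancedSplit (R ∪ P) r
    balanced-split {R} {P} {r} (acc smaller) g with ∣ R ∪ P ∣ <? 2 * k
    ... | yes small = take-all g small
    ... | no ¬small with root-neighbour g (≮⇒≥ ¬small)
    ... | c , c∈R , r~c =
      Cut.cut g c∈R r~c (λ R′<R → balanced-split (smaller R′<R)) (≮⇒≥ ¬small)

connected-balanced-split : ∀ {n} (G : Graph n) {k U r} → 1 ≤ k → ConnectedOn G U → r ∈ U →
                           2 * k ≤ ∣ U ∣ → BalancedSplit G k U r
connected-balanced-split G {k} {U} {r} 1≤k U-connected r∈U 2k≤∣U∣ =
  subst (λ U′ → BalancedSplit G k U′ r) (q⊆p⇒p∪q≡p (⁅x⁆⊆p r∈U))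
    (balanced-split G k 1≤k (<-wellFounded ∣ U ∣)
      (glued-⁅⁆ G k 1≤k U-connected r∈U (≤-trans (n≤2*n k) 2k≤∣U∣)))

lemma2p10 : (k n : ℕ) → 1 ≤ k → 2 * k ≤ n → (T : Graph n) → IsTree T →
    Σ (Subset n) λ VA → Σ (Subset n) λ VB →
      (VA ∪ VB ≡ ⊤) × IsTreeOn T VA × IsTreeOn T VB ×
      (∣ VA ∩ VB ∣ ≤ 1) × (k ≤ ∣ VA ∣) × (∣ VA ∣ < 2 * k)
lemma2p10 k n 1≤k 2k≤n T (T-connected@((r , _) , _) , T-acyclic) =
  VA , VB , union ,
  (VA-connected , AcyclicOn-⊆ T ⊆⊤ T-acyclic) , (VB-connected , AcyclicOn-⊆ T ⊆⊤ T-acyclic) ,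
  ∣VA∩VB∣≤1 , k≤∣VA∣ , ∣VA∣<2k
  where
  open BalancedSplit
    (connected-balanced-split T {r = r} 1≤k T-connected ∈⊤ (subst (2 * k ≤_) (sym (∣⊤∣≡n n)) 2k≤n))
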